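{- Let $k\le n$ be positive integers and $\delta\in[0,1]$. Suppose $\pi$ is drawn from a distribution over permutations of $[n]$ satisfying the $(k,\delta)$-uniform-induced-ordering property, and let $\{x_1,\dots,x_p\}\subseteq[n]$ be an arbitrary set of $p$ distinct items. Let $\sigma$ be a uniformly random permutation of $[n]$ and define $\phi(i)=\sigma(i)/n$ (a uniformly random bijection $[n]\to\{i/n:i\in[n]\}$). Define $X_i=\pi(x_i)/n$ for $i\in[p]$. Then for all nonnegative integers $k_1,\dots,k_p$ with $k_i\le\frac{k}{2p}$ for every $i$, \[\mathbb E\Bigl[\prod_{i=1}^pX_i^{k_i}\Bigr]\ge(1-\delta)\,\mathbb E\Bigl[\prod_{i=1}^p\phi(i)^{k_i}\Bigr].\]
   Context: $\pi(i)$ denotes the position of item $i$ in the arrival order. $(k,\delta)$-uniform-induced-ordering property: for every $k$ distinct items $y_1,\dots,y_k\in[n]$, $\Pr[\pi(y_1)<\dots<\pi(y_k)]\ge(1-\delta)/k!$.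
   Formalization: The parameter δ and the probabilities of the distribution over permutations are rational. -}

module Defs where

import Data.Nat.Properties
open import Data.Nat as ℕ using (ℕ; zero; suc; NonZero)
open import Data.Fin as Fin using (Fin; toℕ)
open import Data.Fin.Properties using (all?; _≟_)
open import Data.Integer using (+_)
open import Data.Rational using (ℚ; 0ℚ; 1ℚ; _+_; _*_; _/_)
open import Data.List using (List; []; _∷_; map; concatMap; filter; length)
open import Data.List.Relation.Unary.All using (All)
open import Data.Product using (_×_; _,_; proj₁; proj₂)
open import Data.Vec.Functional using () renaming (_∷_ to _∷ᶠ_)
open import Relation.Binary.PropositionalEquality using (_≡_)
open import Relation.Nullary.Decidable using (Dec; _→-dec_)
open import Relation.Unary using (Decidable)

_^ℚ_ : ℚ → ℕ → ℚ
q ^ℚ zero  = 1ℚ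
q ^ℚ suc m = q * (q ^ℚ m)

prodFin : (p : ℕ) → (Fin p → ℚ) → ℚ
prodFin zero    f = 1ℚ
prodFin (suc p) f = f Fin.zero * prodFin p (λ i → f (Fin.suc i))

-- A permutation of [n] is an injective (hence bijective) map Fin n → Fin n;
-- π j is the (0-based) position of item j in the arrival order.
Endo : ℕ → Set
Endo n = Fin n → Fin n

IsPerm : ∀ {n} → Endo n → Set
IsPerm {n} f = ∀ (i j : Fin n) → f i ≡ f j → i ≡ j

isPerm? : ∀ {n} → Decidable (IsPerm {n})
isPerm? f = all? (λ i → all? (λ j → (f i ≟ f j) →-dec (i ≟ j)))

allFuns : (m n : ℕ) → List (Fin m → Fin n)
allFuns zero    n = (λ ()) ∷ []
allFuns (suc m) n = concatMap (λ f → map (λ j → j ∷ᶠ f) (Data.List.allFin n)) (allFuns m n)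

allPerms : (n : ℕ) → List (Endo n)
allPerms n = filter isPerm? (allFuns n n)

sumℚ : List ℚ → ℚ
sumℚ []       = 0ℚ
sumℚ (x ∷ xs) = x + sumℚ xs

-- Average of a list (the empty list never occurs below).
avg : List ℚ → ℚ
avg []         = 0ℚ
avg (x ∷ xs)   = sumℚ (x ∷ xs) * ((+ 1) / suc (length xs))

EUnif : (n : ℕ) → (Endo n → ℚ) → ℚ
EUnif n f = avg (map f (allPerms n))

-- A finitely supported distribution over permutations of [n]:
-- a list of (permutation, probability weight) pairs.
Dist : ℕ → Set
Dist n = List (Endo n × ℚ)

IsDist : ∀ {n} → Dist n → Set
IsDist D = All (λ e → IsPerm (proj₁ e) × (0ℚ Data.Rational.≤ proj₂ e)) D
         × sumℚ (map proj₂ D) ≡ 1ℚ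

E : ∀ {n} → Dist n → (Endo n → ℚ) → ℚ
E D f = sumℚ (map (λ e → proj₂ e * f (proj₁ e)) D)

Pr : ∀ {n} → Dist n → {P : Endo n → Set} → Decidable P → ℚ
Pr D P? = sumℚ (map proj₂ (filter (λ e → P? (proj₁ e)) D))

InducedOrder : ∀ {n k} → (Fin k → Fin n) → Endo n → Set
InducedOrder {n} {k} y π = ∀ (i j : Fin k) → i Fin.< j → π (y i) Fin.< π (y j)

inducedOrder? : ∀ {n k} (y : Fin k → Fin n) → Decidable (InducedOrder y)
inducedOrder? y π = all? (λ i → all? (λ j → (i Fin.<? j) →-dec (π (y i) Fin.<? π (y j))))

UIO : ∀ {n} → (k : ℕ) → ℚ → Dist n → Set
UIO {n} k δ D = ∀ (y : Fin k → Fin n) → (∀ i j → y i ≡ y j → i ≡ j) →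
  (1ℚ Data.Rational.- δ) * ((+ 1) / (k ℕ.!)) {{Data.Nat.Properties._!≢0 k}} Data.Rational.≤ Pr D (inducedOrder? y)


-- The scaled position (position in {1,…,n}) divided by n: π(j)/n.
scaledPos : ∀ {n} {{_ : NonZero n}} → Endo n → Fin n → ℚ
scaledPos {n} π j = (+ suc (toℕ (π j))) / n

{-# OPTIONS --safe #-}

-- Since π(x) + 1 = #{j : π j ≤ π x}, the monomial ∏ᵢ ((π(xᵢ) + 1)/n)^kᵢ expands into a
-- nonnegative combination of indicators of constraint sets C = {π u ≤ π v, ...}, each
-- mentioning at most 2 ∑ᵢ kᵢ ≤ k items.  Cover these items by k distinct items y.  The
-- permutations fall into k! classes according to the order that π induces on y, and each
-- indicator is constant on a class.  Under the uniform distribution every class has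
-- probability exactly 1/k!: exactly one relabelling y ∘ τ is sorted by π, and by
-- exchangeability all relabellings are equally likely.  Under D every class has probability
-- at least (1-δ)/k!, which gives the inequality for the items x; exchangeability once more
-- replaces x by the first p items on the uniform side.

module Submission where

open import Defs
open import Data.Nat using (ℕ; NonZero; _≤_; _*_)
open import Data.Fin using (Fin; inject≤)
open import Data.Rational using (ℚ; 0ℚ; 1ℚ; _-_) renaming (_*_ to _*ℚ_; _≤_ to _≤ℚ_)
open import Relation.Binary.PropositionalEquality using (_≡_)

open import Algebra.Bundles using (CommutativeMonoid; Ring)
open import Data.Bool using (if_then_else_)
open import Data.Fin as Fin using (zero; suc; punchIn; punchOut; toℕ)
open import Data.Fin.Permutation using (permutation)
open import Data.Fin.Permutation.Components using (transpose; transpose-inverse)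
open import Data.Fin.Properties
  using ( _≟_; any?; all?; 0≢1+n; ≤-totalOrder; injective⇒≤; suc-injective
        ; inject≤-injective; inject≤-trans; toℕ-inject≤
        ; punchOut-injective; punchIn-injective; punchInᵢ≢i; punchIn-punchOut )
import Data.Fin.Properties as Finₚ
import Data.Integer as ℤ
import Data.Integer.Properties as ℤₚ
open import Data.List using (List; []; _∷_; _++_; map; concatMap; filter; allFin; tabulate; length)
import Data.List.Extrema as Extrema
open import Data.List.Membership.Propositional.Properties using (∈-allFin)
open import Data.List.Properties using (length-map)
open import Data.List.Relation.Unary.All as All using (All; []; _∷_)
open import Data.List.Relation.Unary.All.Properties using (all-filter; map⁺; ++⁺; tabulate⁺)
import Data.Nat as ℕ
open import Data.Nat using (zero; suc; z≤n; s≤s; _!)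
import Data.Nat.Properties as ℕₚ
open import Data.Product using (Σ; ∃; ∃₂; _×_; _,_; proj₁; proj₂)
open import Data.Rational using (_+_; _/_)
import Data.Rational as ℚ
import Data.Rational.Properties as ℚₚ
import Data.Rational.Unnormalised as ℚᵘ
import Data.Rational.Unnormalised.Properties as ℚᵘₚ
open import Data.Vec.Functional using (insertAt) renaming (_∷_ to _∷ᶠ_)
open import Data.Vec.Functional.Properties using (insertAt-lookup; insertAt-punchIn)
open import Function using (_∘_)
open import Relation.Binary.Definitions using (tri<; tri≈; tri>)
open import Relation.Binary.PropositionalEquality
  using (refl; sym; trans; cong; cong₂; subst; subst₂; _≗_; _≢_; module ≡-Reasoning)
open import Relation.Nullary using (Dec; yes; no; does; ¬_; contradiction)
open import Relation.Nullary.Decidable using (_×-dec_; _→-dec_; dec-true; dec-false)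
open import Relation.Unary using (Decidable)

open import Algebra.Properties.CommutativeMonoid.Sum ℚₚ.+-0-commutativeMonoid
  using ( sum; sum-syntax; ∑-distrib-+; ∑-comm; sum-remove; ∑-permute
        ; sum-replicate; sum-replicate-zero; sum-cong-≗ )
open import Algebra.Properties.Semiring.Mult (Ring.semiring ℚₚ.+-*-ring)
  using (×-assocˡ) renaming (_×_ to _×ℚ_)
open import Algebra.Properties.CommutativeSemigroup
  (CommutativeMonoid.commutativeSemigroup ℚₚ.+-0-commutativeMonoid)
  using () renaming (interchange to +-interchange)
open import Algebra.Properties.CommutativeSemigroup
  (CommutativeMonoid.commutativeSemigroup ℚₚ.*-1-commutativeMonoid)
  using () renaming (x∙yz≈y∙xz to x*yz≈y*xz; xy∙z≈x∙zy to xy*z≈x*zy; interchange to *-interchange)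

private variable A B P Q : Set

∑ₗ : List A → (A → ℚ) → ℚ
∑ₗ l f = sumℚ (map f l)

infix 10 ∑ₗ
syntax ∑ₗ l (λ a → x) = ∑[ a ∈ l ] x

∑ₗ-cong : ∀ (l : List A) {f g : A → ℚ} → f ≗ g → ∑ₗ l f ≡ ∑ₗ l g
∑ₗ-cong []      f≗g = refl
∑ₗ-cong (a ∷ l) f≗g = cong₂ _+_ (f≗g a) (∑ₗ-cong l f≗g)

∑ₗ-cong-All : ∀ {l : List A} {f g : A → ℚ} → All (λ a → f a ≡ g a) l → ∑ₗ l f ≡ ∑ₗ l g
∑ₗ-cong-All []            = refl
∑ₗ-cong-All (fa≡ga ∷ eqs) = cong₂ _+_ fa≡ga (∑ₗ-cong-All eqs)

∑ₗ-++ : ∀ (l l′ : List A) (f : A → ℚ) → ∑ₗ (l ++ l′) f ≡ ∑ₗ l f + ∑ₗ l′ f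
∑ₗ-++ []      l′ f = sym (ℚₚ.+-identityˡ _)
∑ₗ-++ (a ∷ l) l′ f = trans (cong (f a +_) (∑ₗ-++ l l′ f)) (sym (ℚₚ.+-assoc (f a) (∑ₗ l f) (∑ₗ l′ f)))

∑ₗ-concatMap : (h : A → List B) (l : List A) (f : B → ℚ) →
               ∑ₗ (concatMap h l) f ≡ ∑[ a ∈ l ] ∑ₗ (h a) f
∑ₗ-concatMap h []      f = refl
∑ₗ-concatMap h (a ∷ l) f =
  trans (∑ₗ-++ (h a) (concatMap h l) f) (cong (∑ₗ (h a) f +_) (∑ₗ-concatMap h l f))

∑ₗ-map : (h : A → B) (l : List A) (f : B → ℚ) → ∑ₗ (map h l) f ≡ ∑ₗ l (f ∘ h)
∑ₗ-map h []      f = refl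
∑ₗ-map h (a ∷ l) f = cong (f (h a) +_) (∑ₗ-map h l f)

∑ₗ-zero : ∀ (l : List A) → ∑[ a ∈ l ] 0ℚ ≡ 0ℚ
∑ₗ-zero []      = refl
∑ₗ-zero (a ∷ l) = trans (ℚₚ.+-identityˡ _) (∑ₗ-zero l)

∑ₗ-*ˡ : ∀ (l : List A) c (f : A → ℚ) → ∑[ a ∈ l ] (c *ℚ f a) ≡ c *ℚ ∑ₗ l f
∑ₗ-*ˡ []      c f = sym (ℚₚ.*-zeroʳ c)
∑ₗ-*ˡ (a ∷ l) c f = trans (cong (c *ℚ f a +_) (∑ₗ-*ˡ l c f)) (sym (ℚₚ.*-distribˡ-+ c _ _))

∑ₗ-*ʳ : ∀ (l : List A) c (f : A → ℚ) → ∑[ a ∈ l ] (f a *ℚ c) ≡ ∑ₗ l f *ℚ c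
∑ₗ-*ʳ l c f = trans (∑ₗ-cong l (λ a → ℚₚ.*-comm (f a) c)) (trans (∑ₗ-*ˡ l c f) (ℚₚ.*-comm c _))

∑ₗ-distrib-+ : ∀ (l : List A) (f g : A → ℚ) → ∑[ a ∈ l ] (f a + g a) ≡ ∑ₗ l f + ∑ₗ l g
∑ₗ-distrib-+ []      f g = sym (ℚₚ.+-identityˡ 0ℚ)
∑ₗ-distrib-+ (a ∷ l) f g =
  trans (cong (f a + g a +_) (∑ₗ-distrib-+ l f g)) (+-interchange (f a) (g a) (∑ₗ l f) (∑ₗ l g))

∑ₗ-∑-comm : ∀ (l : List A) n (f : A → Fin n → ℚ) →
            ∑[ a ∈ l ] ∑[ i < n ] f a i ≡ ∑[ i < n ] ∑[ a ∈ l ] f a i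
∑ₗ-∑-comm []      n f = sym (sum-replicate-zero n)
∑ₗ-∑-comm (a ∷ l) n f =
  trans (cong (sum (f a) +_) (∑ₗ-∑-comm l n f)) (sym (∑-distrib-+ (f a) _))

∑ₗ-comm : (l : List A) (l′ : List B) (f : A → B → ℚ) →
          ∑[ a ∈ l ] ∑[ b ∈ l′ ] f a b ≡ ∑[ b ∈ l′ ] ∑[ a ∈ l ] f a b
∑ₗ-comm []      l′ f = sym (∑ₗ-zero l′)
∑ₗ-comm (a ∷ l) l′ f =
  trans (cong (∑ₗ l′ (f a) +_) (∑ₗ-comm l l′ f)) (sym (∑ₗ-distrib-+ l′ (f a) _))

∑ₗ-mono : ∀ {l : List A} {f g : A → ℚ} → All (λ a → f a ≤ℚ g a) l → ∑ₗ l f ≤ℚ ∑ₗ l g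
∑ₗ-mono []            = ℚₚ.≤-refl
∑ₗ-mono (fa≤ga ∷ les) = ℚₚ.+-mono-≤ fa≤ga (∑ₗ-mono les)

∑ₗ-scaled-mono : ∀ (l : List A) a {c x y : A → ℚ} → All (λ t → 0ℚ ≤ℚ c t × a *ℚ x t ≤ℚ y t) l →
                 a *ℚ ∑[ t ∈ l ] (c t *ℚ x t) ≤ℚ ∑[ t ∈ l ] (c t *ℚ y t)
∑ₗ-scaled-mono l a {c} {x} {y} bounds = begin
  a *ℚ ∑[ t ∈ l ] (c t *ℚ x t)     ≡⟨ ∑ₗ-*ˡ l a (λ t → c t *ℚ x t) ⟨
  ∑[ t ∈ l ] (a *ℚ (c t *ℚ x t))   ≡⟨ ∑ₗ-cong l (λ t → x*yz≈y*xz a (c t) (x t)) ⟩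
  ∑[ t ∈ l ] (c t *ℚ (a *ℚ x t))   ≤⟨ ∑ₗ-mono (All.map scale bounds) ⟩
  ∑[ t ∈ l ] (c t *ℚ y t)          ∎
  where
  open ℚₚ.≤-Reasoning
  scale : ∀ {t} → 0ℚ ≤ℚ c t × a *ℚ x t ≤ℚ y t → c t *ℚ (a *ℚ x t) ≤ℚ c t *ℚ y t
  scale {t} (0≤c , ax≤y) = ℚₚ.*-monoˡ-≤-nonNeg (c t) {{ℚ.nonNegative 0≤c}} ax≤y

∑ₗ-tabulate : ∀ m (g : Fin m → A) (f : A → ℚ) → ∑ₗ (tabulate g) f ≡ ∑[ i < m ] f (g i)
∑ₗ-tabulate zero    g f = refl
∑ₗ-tabulate (suc m) g f = cong (f (g zero) +_) (∑ₗ-tabulate m (g ∘ suc) f)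

∑ₗ-allFin : ∀ n (f : Fin n → ℚ) → ∑[ i ∈ allFin n ] f i ≡ ∑[ i < n ] f i
∑ₗ-allFin n = ∑ₗ-tabulate n (λ i → i)

∑ₗ-const : ∀ (l : List A) c → ∑[ a ∈ l ] c ≡ length l ×ℚ c
∑ₗ-const []      c = refl
∑ₗ-const (a ∷ l) c = cong (c +_) (∑ₗ-const l c)

𝟙 : Dec P → ℚ
𝟙 p? = if does p? then 1ℚ else 0ℚ

𝟙-yes : (p? : Dec P) → P → 𝟙 p? ≡ 1ℚ
𝟙-yes (yes _) _ = refl
𝟙-yes (no ¬p) p = contradiction p ¬p

𝟙-no : (p? : Dec P) → ¬ P → 𝟙 p? ≡ 0ℚ
𝟙-no (no _)  _  = refl
𝟙-no (yes p) ¬p = contradiction p ¬p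

𝟙-⇔ : (p? : Dec P) (q? : Dec Q) → (P → Q) → (Q → P) → 𝟙 p? ≡ 𝟙 q?
𝟙-⇔ (yes p) q? to from = sym (𝟙-yes q? (to p))
𝟙-⇔ (no ¬p) q? to from = sym (𝟙-no q? (¬p ∘ from))

𝟙-× : (p? : Dec P) (q? : Dec Q) → 𝟙 (p? ×-dec q?) ≡ 𝟙 p? *ℚ 𝟙 q?
𝟙-× (yes _) (yes _) = refl
𝟙-× (yes _) (no _)  = refl
𝟙-× (no _)  q?      = sym (ℚₚ.*-zeroˡ (𝟙 q?))

*-𝟙-cong : ∀ {a b} (p? : Dec P) → (P → a ≡ b) → a *ℚ 𝟙 p? ≡ b *ℚ 𝟙 p?
*-𝟙-cong (yes p) a≡b = cong (_*ℚ 1ℚ) (a≡b p)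
*-𝟙-cong {a = a} {b} (no _) _ = trans (ℚₚ.*-zeroʳ a) (sym (ℚₚ.*-zeroʳ b))

𝟙-nonNeg : (p? : Dec P) → 0ℚ ≤ℚ 𝟙 p?
𝟙-nonNeg (yes _) = ℚₚ.nonNegative⁻¹ 1ℚ
𝟙-nonNeg (no _)  = ℚₚ.≤-refl

∑ₗ-filter : ∀ {P : A → Set} (P? : Decidable P) (l : List A) (f : A → ℚ) →
            ∑ₗ (filter P? l) f ≡ ∑[ a ∈ l ] (𝟙 (P? a) *ℚ f a)
∑ₗ-filter P? []      f = refl
∑ₗ-filter P? (a ∷ l) f with P? a
... | yes _ = cong₂ _+_ (sym (ℚₚ.*-identityˡ (f a))) (∑ₗ-filter P? l f)
... | no _  = trans (∑ₗ-filter P? l f) (sym (trans (cong (_+ _) (ℚₚ.*-zeroˡ (f a))) (ℚₚ.+-identityˡ _)))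

/-cross : ∀ a b c d → a ℤ.* ℤ.+ suc d ≡ b ℤ.* ℤ.+ suc c → a / suc c ≡ b / suc d
/-cross a b c d eq = ℚₚ.fromℚᵘ-cong {ℚᵘ.mkℚᵘ a c} {ℚᵘ.mkℚᵘ b d} (ℚᵘ.*≡* eq)

n/n≡1 : ∀ d .{{_ : NonZero d}} → ℤ.+ d / d ≡ 1ℚ
n/n≡1 (suc d) = /-cross (ℤ.+ suc d) ℤ.1ℤ d 0 (ℤₚ.*-comm (ℤ.+ suc d) ℤ.1ℤ)

+-/ : ∀ a b d .{{_ : NonZero d}} → ℤ.+ a / d + ℤ.+ b / d ≡ ℤ.+ (a ℕ.+ b) / d
+-/ a b (suc d) = ℚₚ.toℚᵘ-injective
  (ℚᵘₚ.≃-trans (ℚₚ.toℚᵘ-homo-+ (ℤ.+ a / suc d) (ℤ.+ b / suc d))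
  (ℚᵘₚ.≃-trans (ℚᵘₚ.+-cong (ℚₚ.toℚᵘ-fromℚᵘ (ℚᵘ.mkℚᵘ (ℤ.+ a) d)) (ℚₚ.toℚᵘ-fromℚᵘ (ℚᵘ.mkℚᵘ (ℤ.+ b) d)))
  (ℚᵘₚ.≃-trans (ℚᵘ.*≡* cross) (ℚᵘₚ.≃-sym (ℚₚ.toℚᵘ-fromℚᵘ (ℚᵘ.mkℚᵘ (ℤ.+ (a ℕ.+ b)) d))))))
  where
  D : ℤ.ℤ
  D = ℤ.+ suc d

  cross : (ℤ.+ a ℤ.* D ℤ.+ ℤ.+ b ℤ.* D) ℤ.* D ≡ ℤ.+ (a ℕ.+ b) ℤ.* (D ℤ.* D)
  cross = trans (cong (ℤ._* D) (sym (ℤₚ.*-distribʳ-+ D (ℤ.+ a) (ℤ.+ b))))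
         (trans (ℤₚ.*-assoc (ℤ.+ a ℤ.+ ℤ.+ b) D D) (cong (ℤ._* (D ℤ.* D)) (sym (ℤₚ.pos-+ a b))))

×-1/ : ∀ m d .{{_ : NonZero d}} → m ×ℚ (ℤ.1ℤ / d) ≡ ℤ.+ m / d
×-1/ zero    d = sym (ℚₚ.0/n≡0 d)
×-1/ (suc m) d = trans (cong (ℤ.1ℤ / d +_) (×-1/ m d)) (+-/ 1 m d)

×-monoʳ-< : ∀ m {p q} → p ℚ.< q → suc m ×ℚ p ℚ.< suc m ×ℚ q
×-monoʳ-< zero    p<q = ℚₚ.+-mono-<-≤ p<q ℚₚ.≤-refl
×-monoʳ-< (suc m) p<q = ℚₚ.+-mono-< p<q (×-monoʳ-< m p<q)

×-cancelˡ : ∀ m .{{_ : NonZero m}} {p q} → m ×ℚ p ≡ m ×ℚ q → p ≡ q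
×-cancelˡ (suc m) {p} {q} eq with ℚₚ.<-cmp p q
... | tri< p<q _ _ = contradiction eq (ℚₚ.<⇒≢ (×-monoʳ-< m p<q))
... | tri≈ _ p≡q _ = p≡q
... | tri> _ _ q<p = contradiction (sym eq) (ℚₚ.<⇒≢ (×-monoʳ-< m q<p))

Inj : ∀ {m n} → (Fin m → Fin n) → Set
Inj {m} f = ∀ (i j : Fin m) → f i ≡ f j → i ≡ j

Inj-∘ : ∀ {m n o} {f : Fin m → Fin n} {g : Fin n → Fin o} → Inj f → Inj g → Inj (g ∘ f)
Inj-∘ f-inj g-inj i j = f-inj i j ∘ g-inj _ _

Inj-suc : ∀ {m} → Inj (suc {m})
Inj-suc _ _ = suc-injective

Inj-≗ : ∀ {m n} {f g : Fin m → Fin n} → f ≗ g → Inj f → Inj g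
Inj-≗ f≗g f-inj i j gi≡gj = f-inj i j (trans (f≗g i) (trans gi≡gj (sym (f≗g j))))

isPerm⇒surjective : ∀ {n} {π : Endo n} → IsPerm π → ∀ v → ∃ λ i → π i ≡ v
isPerm⇒surjective {suc m} {π} π-inj v with any? (λ i → π i ≟ v)
... | yes hit = hit
... | no  miss = contradiction (injective⇒≤ squeezed-inj) ℕₚ.1+n≰n
  where
  v≢π : ∀ i → v ≢ π i
  v≢π i v≡πi = miss (i , sym v≡πi)

  squeezed : Fin (suc m) → Fin m
  squeezed i = punchOut (v≢π i)

  squeezed-inj : ∀ {i j} → squeezed i ≡ squeezed j → i ≡ j
  squeezed-inj {i} {j} = π-inj i j ∘ punchOut-injective (v≢π i) (v≢π j)

∑-reindex : ∀ {n} {π : Endo n} → IsPerm π → (f : Fin n → ℚ) → ∑[ i < n ] f (π i) ≡ ∑[ i < n ] f i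
∑-reindex {n} {π} π-perm f = sym (∑-permute f (permutation π π⁻¹ π∘π⁻¹ π⁻¹∘π))
  where
  π⁻¹ : Endo n
  π⁻¹ v = proj₁ (isPerm⇒surjective π-perm v)

  π∘π⁻¹ : ∀ v → π (π⁻¹ v) ≡ v
  π∘π⁻¹ v = proj₂ (isPerm⇒surjective π-perm v)

  π⁻¹∘π : ∀ i → π⁻¹ (π i) ≡ i
  π⁻¹∘π i = π-perm _ _ (π∘π⁻¹ (π i))

transpose-here : ∀ {n} (i j : Fin n) → transpose i j i ≡ j
transpose-here i j rewrite dec-true (i ≟ i) refl = refl

transpose-away : ∀ {n} {i j k : Fin n} → k ≢ i → k ≢ j → transpose i j k ≡ k
transpose-away {i = i} {j} {k} k≢i k≢j rewrite dec-false (k ≟ i) k≢i | dec-false (k ≟ j) k≢j = refl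

transpose-isPerm : ∀ {n} (i j : Fin n) → IsPerm (transpose i j)
transpose-isPerm i j k l eq =
  trans (sym (transpose-inverse j i)) (trans (cong (transpose j i) eq) (transpose-inverse j i))

extend-injection : ∀ {m n} (u v : Fin m → Fin n) → Inj u → Inj v →
                   ∃ λ (γ : Endo n) → IsPerm γ × (∀ i → γ (u i) ≡ v i)
extend-injection {zero}  u v u-inj v-inj = (λ k → k) , (λ _ _ eq → eq) , λ ()
extend-injection {suc m} u v u-inj v-inj
  with extend-injection (u ∘ suc) (v ∘ suc) (Inj-∘ Inj-suc u-inj) (Inj-∘ Inj-suc v-inj)
... | γ , γ-perm , γu≡v = transpose a (v zero) ∘ γ , Inj-∘ γ-perm (transpose-isPerm a (v zero)) , carries
  where
  a : Fin _
  a = γ (u zero)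

  carries : ∀ i → transpose a (v zero) (γ (u i)) ≡ v i
  carries zero    = transpose-here a (v zero)
  carries (suc i) = trans (cong (transpose a (v zero)) (γu≡v i)) (transpose-away v≢a v≢v₀)
    where
    v≢a : v (suc i) ≢ a
    v≢a eq with u-inj _ _ (γ-perm _ _ (trans (γu≡v i) eq))
    ... | ()
    v≢v₀ : v (suc i) ≢ v zero
    v≢v₀ eq with v-inj _ _ eq
    ... | ()

Covers : ∀ {m n} → (Fin m → Fin n) → List (Fin n) → Set
Covers w = All (λ v → ∃ λ i → w i ≡ v)

injective-cover : ∀ {n} (zs : List (Fin n)) →
                  ∃ λ m → Σ (Fin m → Fin n) λ w → Inj w × m ≤ length zs × Covers w zs
injective-cover [] = 0 , (λ ()) , (λ ()) , z≤n , []
injective-cover (z ∷ zs) with injective-cover zs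
... | m , w , w-inj , m≤ , covers with any? (λ i → w i ≟ z)
...   | yes hit  = m , w , w-inj , ℕₚ.m≤n⇒m≤1+n m≤ , hit ∷ covers
...   | no  miss = suc m , z ∷ᶠ w , z∷w-inj , s≤s m≤ , (zero , refl) ∷ All.map shift covers
  where
  shift : ∀ {v} → ∃ (λ i → w i ≡ v) → ∃ (λ i → (z ∷ᶠ w) i ≡ v)
  shift (i , wi≡v) = suc i , wi≡v

  z∷w-inj : Inj (z ∷ᶠ w)
  z∷w-inj zero    zero    _  = refl
  z∷w-inj zero    (suc j) eq = contradiction (j , sym eq) miss
  z∷w-inj (suc i) zero    eq = contradiction (i , eq) miss
  z∷w-inj (suc i) (suc j) eq = cong suc (w-inj i j eq)

extend-domain : ∀ {m k n} {w : Fin m → Fin n} → Inj w → (m≤k : m ≤ k) → k ≤ n →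
                ∃ λ (y : Fin k → Fin n) → Inj y × (∀ i → y (inject≤ i m≤k) ≡ w i)
extend-domain {w = w} w-inj m≤k k≤n
  with extend-injection (λ i → inject≤ i (ℕₚ.≤-trans m≤k k≤n)) w (inject≤-injective _ _) w-inj
... | γ , γ-perm , γι≡w =
  (λ i → γ (inject≤ i k≤n)) , Inj-∘ (inject≤-injective k≤n k≤n) γ-perm ,
  λ i → trans (cong γ (inject≤-trans i m≤k k≤n)) (γι≡w i)

cover-by-injection : ∀ {k n} (zs : List (Fin n)) → length zs ≤ k → k ≤ n →
                     ∃ λ (y : Fin k → Fin n) → Inj y × Covers y zs
cover-by-injection zs |zs|≤k k≤n with injective-cover zs
... | m , w , w-inj , m≤|zs| , covers with extend-domain w-inj (ℕₚ.≤-trans m≤|zs| |zs|≤k) k≤n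
...   | y , y-inj , y-extends = y , y-inj , All.map recover covers
  where
  recover : ∀ {v} → ∃ (λ i → w i ≡ v) → ∃ (λ i → y i ≡ v)
  recover (i , wi≡v) = inject≤ i _ , trans (y-extends i) wi≡v

-- Sums over functions and permutations

Extensional : ∀ {m n} → ((Fin m → Fin n) → ℚ) → Set
Extensional F = ∀ {f g} → f ≗ g → F f ≡ F g

insertAt-≗ : ∀ {m} {f g : Fin m → A} (c : Fin (suc m)) x → f ≗ g → insertAt f c x ≗ insertAt g c x
insertAt-≗         zero    x f≗g zero    = refl
insertAt-≗         zero    x f≗g (suc i) = f≗g i
insertAt-≗ {m = suc m} (suc c) x f≗g zero    = f≗g zero
insertAt-≗ {m = suc m} (suc c) x f≗g (suc i) = insertAt-≗ c x (f≗g ∘ suc) i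

insertAt-zero : ∀ {m} (g : Fin m → A) x → (x ∷ᶠ g) ≗ insertAt g zero x
insertAt-zero g x zero    = refl
insertAt-zero g x (suc i) = refl

insertAt-suc : ∀ {m} (g : Fin m → A) c y x → (y ∷ᶠ insertAt g c x) ≗ insertAt (y ∷ᶠ g) (suc c) x
insertAt-suc g c y x zero    = refl
insertAt-suc g c y x (suc i) = refl

∷-≗ : ∀ {m} (x : A) {g g′ : Fin m → A} → g ≗ g′ → (x ∷ᶠ g) ≗ (x ∷ᶠ g′)
∷-≗ x g≗g′ zero    = refl
∷-≗ x g≗g′ (suc i) = g≗g′ i

∑-allFuns-suc : ∀ {m n} (F : (Fin (suc m) → Fin n) → ℚ) →
                ∑[ f ∈ allFuns (suc m) n ] F f ≡ ∑[ g ∈ allFuns m n ] ∑[ j < n ] F (j ∷ᶠ g)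
∑-allFuns-suc {m} {n} F = trans (∑ₗ-concatMap _ (allFuns m n) F) (∑ₗ-cong (allFuns m n) λ g →
  trans (∑ₗ-map (_∷ᶠ g) (allFin n) F) (∑ₗ-allFin n (F ∘ (_∷ᶠ g))))

∑-allFuns-insertAt : ∀ {m n} (c : Fin (suc m)) {F : (Fin (suc m) → Fin n) → ℚ} → Extensional F →
                     ∑[ f ∈ allFuns (suc m) n ] F f ≡ ∑[ g ∈ allFuns m n ] ∑[ j < n ] F (insertAt g c j)
∑-allFuns-insertAt {m} {n} zero {F} F-ext =
  trans (∑-allFuns-suc F) (∑ₗ-cong (allFuns m n) λ g → sum-cong-≗ λ j → F-ext (insertAt-zero g j))
∑-allFuns-insertAt {suc m} {n} (suc c) {F} F-ext = begin
  ∑[ f ∈ allFuns (suc (suc m)) n ] F f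
    ≡⟨ ∑-allFuns-suc F ⟩
  ∑[ g ∈ allFuns (suc m) n ] G g
    ≡⟨ ∑-allFuns-insertAt c (λ g≗g′ → sum-cong-≗ λ j → F-ext (∷-≗ j g≗g′)) ⟩
  ∑[ h ∈ allFuns m n ] ∑[ j′ < n ] ∑[ j < n ] F (j ∷ᶠ insertAt h c j′)
    ≡⟨ ∑ₗ-cong (allFuns m n) (λ h → ∑-comm λ j′ j → F (j ∷ᶠ insertAt h c j′)) ⟩
  ∑[ h ∈ allFuns m n ] ∑[ j < n ] ∑[ j′ < n ] F (j ∷ᶠ insertAt h c j′)
    ≡⟨ ∑ₗ-cong (allFuns m n) (λ h → sum-cong-≗ λ j → sum-cong-≗ λ j′ → F-ext (insertAt-suc h c j j′)) ⟩
  ∑[ h ∈ allFuns m n ] ∑[ j < n ] ∑[ j′ < n ] F (insertAt (j ∷ᶠ h) (suc c) j′)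
    ≡⟨ sym (∑-allFuns-suc (λ g → ∑[ j′ < n ] F (insertAt g (suc c) j′))) ⟩
  ∑[ g ∈ allFuns (suc m) n ] ∑[ j′ < n ] F (insertAt g (suc c) j′) ∎
  where
  open ≡-Reasoning
  G : (Fin (suc m) → Fin n) → ℚ
  G g = ∑[ j < n ] F (j ∷ᶠ g)

-- With c = γ⁻¹ 0, precomposing x ∷ g with γ inserts x at position c into g ∘ γ′, where γ′
-- is γ with c and 0 removed; induct on the remaining arguments.
∑-allFuns-∘ʳ : ∀ {m n} {γ : Endo m} → IsPerm γ → {F : (Fin m → Fin n) → ℚ} → Extensional F →
               ∑[ f ∈ allFuns m n ] F (f ∘ γ) ≡ ∑[ f ∈ allFuns m n ] F f
∑-allFuns-∘ʳ {zero}        γ-perm F-ext = cong (_+ 0ℚ) (F-ext λ ())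
∑-allFuns-∘ʳ {suc m} {n} {γ} γ-perm {F} F-ext = begin
  ∑[ f ∈ allFuns (suc m) n ] F (f ∘ γ)
    ≡⟨ ∑-allFuns-suc (F ∘ (_∘ γ)) ⟩
  ∑[ g ∈ allFuns m n ] ∑[ j < n ] F ((j ∷ᶠ g) ∘ γ)
    ≡⟨ ∑ₗ-cong (allFuns m n) (λ g → sum-cong-≗ λ j → F-ext (∷∘γ≗insertAt g j)) ⟩
  ∑[ g ∈ allFuns m n ] ∑[ j < n ] F (insertAt (g ∘ γ′) c j)
    ≡⟨ ∑ₗ-∑-comm (allFuns m n) n (λ g j → F (insertAt (g ∘ γ′) c j)) ⟩
  ∑[ j < n ] ∑[ g ∈ allFuns m n ] F (insertAt (g ∘ γ′) c j)
    ≡⟨ sum-cong-≗ (λ j → ∑-allFuns-∘ʳ γ′-perm (F-ext ∘ insertAt-≗ c j)) ⟩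
  ∑[ j < n ] ∑[ g ∈ allFuns m n ] F (insertAt g c j)
    ≡⟨ sym (∑ₗ-∑-comm (allFuns m n) n (λ g j → F (insertAt g c j))) ⟩
  ∑[ g ∈ allFuns m n ] ∑[ j < n ] F (insertAt g c j)
    ≡⟨ sym (∑-allFuns-insertAt c F-ext) ⟩
  ∑[ f ∈ allFuns (suc m) n ] F f ∎
  where
  open ≡-Reasoning
  c : Fin (suc m)
  c = proj₁ (isPerm⇒surjective γ-perm zero)

  γc≡0 : γ c ≡ zero
  γc≡0 = proj₂ (isPerm⇒surjective γ-perm zero)

  0≢γ : ∀ j → zero ≢ γ (punchIn c j)
  0≢γ j 0≡γ = punchInᵢ≢i c j (γ-perm _ _ (trans (sym 0≡γ) (sym γc≡0)))

  γ′ : Endo m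
  γ′ j = punchOut (0≢γ j)

  γ′-perm : IsPerm γ′
  γ′-perm i j = punchIn-injective c i j ∘ γ-perm _ _ ∘ punchOut-injective (0≢γ i) (0≢γ j)

  ∷∘γ≗insertAt : ∀ g x → (x ∷ᶠ g) ∘ γ ≗ insertAt (g ∘ γ′) c x
  ∷∘γ≗insertAt g x i with i ≟ c
  ... | yes refl = trans (cong (x ∷ᶠ g) γc≡0) (sym (insertAt-lookup (g ∘ γ′) c x))
  ... | no  i≢c  = begin
    (x ∷ᶠ g) (γ i)                          ≡⟨ cong ((x ∷ᶠ g) ∘ γ) (sym i≡c↑j) ⟩
    (x ∷ᶠ g) (γ (punchIn c j))              ≡⟨ cong (x ∷ᶠ g) (sym (punchIn-punchOut (0≢γ j))) ⟩
    g (γ′ j)                                ≡⟨ sym (insertAt-punchIn (g ∘ γ′) c x j) ⟩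
    insertAt (g ∘ γ′) c x (punchIn c j)     ≡⟨ cong (insertAt (g ∘ γ′) c x) i≡c↑j ⟩
    insertAt (g ∘ γ′) c x i                 ∎
    where
    j : Fin m
    j = punchOut (i≢c ∘ sym)

    i≡c↑j : punchIn c j ≡ i
    i≡c↑j = punchIn-punchOut (i≢c ∘ sym)

∑-allFuns-avoiding : ∀ {m n} (a : Fin (suc n)) {F : (Fin m → Fin (suc n)) → ℚ} → Extensional F →
                     (∀ g i → g i ≡ a → F g ≡ 0ℚ) →
                     ∑[ f ∈ allFuns m (suc n) ] F f ≡ ∑[ h ∈ allFuns m n ] F (punchIn a ∘ h)
∑-allFuns-avoiding {zero}      a F-ext F-vanishes = cong (_+ 0ℚ) (F-ext λ ())
∑-allFuns-avoiding {suc m} {n} a {F} F-ext F-vanishes = begin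
  ∑[ f ∈ allFuns (suc m) (suc n) ] F f
    ≡⟨ ∑-allFuns-suc F ⟩
  ∑[ g ∈ allFuns m (suc n) ] ∑[ j < suc n ] F (j ∷ᶠ g)
    ≡⟨ ∑ₗ-cong (allFuns m (suc n)) (λ g → sum-remove {i = a} (λ j → F (j ∷ᶠ g))) ⟩
  ∑[ g ∈ allFuns m (suc n) ] (F (a ∷ᶠ g) + ∑[ j < n ] F (punchIn a j ∷ᶠ g))
    ≡⟨ ∑ₗ-cong (allFuns m (suc n)) (λ g →
         trans (cong (_+ ∑[ j < n ] F (punchIn a j ∷ᶠ g)) (F-vanishes (a ∷ᶠ g) zero refl))
               (ℚₚ.+-identityˡ _)) ⟩
  ∑[ g ∈ allFuns m (suc n) ] ∑[ j < n ] F (punchIn a j ∷ᶠ g)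
    ≡⟨ ∑ₗ-∑-comm (allFuns m (suc n)) n (λ g j → F (punchIn a j ∷ᶠ g)) ⟩
  ∑[ j < n ] ∑[ g ∈ allFuns m (suc n) ] F (punchIn a j ∷ᶠ g)
    ≡⟨ sum-cong-≗ (λ j → ∑-allFuns-avoiding a (F-ext ∘ ∷-≗ (punchIn a j))
                           (λ g i gi≡a → F-vanishes _ (suc i) gi≡a)) ⟩
  ∑[ j < n ] ∑[ h ∈ allFuns m n ] F (punchIn a j ∷ᶠ (punchIn a ∘ h))
    ≡⟨ sym (∑ₗ-∑-comm (allFuns m n) n (λ h j → F (punchIn a j ∷ᶠ (punchIn a ∘ h)))) ⟩
  ∑[ h ∈ allFuns m n ] ∑[ j < n ] F (punchIn a j ∷ᶠ (punchIn a ∘ h))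
    ≡⟨ ∑ₗ-cong (allFuns m n) (λ h → sum-cong-≗ λ j → F-ext (punchIn-∷ h j)) ⟩
  ∑[ h ∈ allFuns m n ] ∑[ j < n ] F (punchIn a ∘ (j ∷ᶠ h))
    ≡⟨ sym (∑-allFuns-suc (F ∘ (punchIn a ∘_))) ⟩
  ∑[ h ∈ allFuns (suc m) n ] F (punchIn a ∘ h) ∎
  where
  open ≡-Reasoning
  punchIn-∷ : ∀ h j → (punchIn a j ∷ᶠ (punchIn a ∘ h)) ≗ punchIn a ∘ (j ∷ᶠ h)
  punchIn-∷ h j zero    = refl
  punchIn-∷ h j (suc i) = refl

∑-allPerms : ∀ {n} (H : Endo n → ℚ) →
             ∑[ σ ∈ allPerms n ] H σ ≡ ∑[ f ∈ allFuns n n ] (𝟙 (isPerm? f) *ℚ H f)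
∑-allPerms {n} H = ∑ₗ-filter isPerm? (allFuns n n) H

𝟙-isPerm-ext : ∀ {n} {H : Endo n → ℚ} → Extensional H → Extensional (λ f → 𝟙 (isPerm? f) *ℚ H f)
𝟙-isPerm-ext H-ext f≗g =
  cong₂ _*ℚ_ (𝟙-⇔ (isPerm? _) (isPerm? _) (Inj-≗ f≗g) (Inj-≗ (sym ∘ f≗g))) (H-ext f≗g)

module _ {k : ℕ} (a : Fin (suc k)) (h : Endo k) where

  isPerm-∷-punchIn⁻ : IsPerm (a ∷ᶠ (punchIn a ∘ h)) → IsPerm h
  isPerm-∷-punchIn⁻ perm i j = suc-injective ∘ perm (suc i) (suc j) ∘ cong (punchIn a)

  isPerm-∷-punchIn⁺ : IsPerm h → IsPerm (a ∷ᶠ (punchIn a ∘ h))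
  isPerm-∷-punchIn⁺ h-perm zero    zero    _  = refl
  isPerm-∷-punchIn⁺ h-perm zero    (suc j) eq = contradiction (sym eq) (punchInᵢ≢i a (h j))
  isPerm-∷-punchIn⁺ h-perm (suc i) zero    eq = contradiction eq (punchInᵢ≢i a (h i))
  isPerm-∷-punchIn⁺ h-perm (suc i) (suc j) eq = cong suc (h-perm i j (punchIn-injective a _ _ eq))

∑-allPerms-suc : ∀ {k} {H : Endo (suc k) → ℚ} → Extensional H →
                 ∑[ τ ∈ allPerms (suc k) ] H τ ≡ ∑[ a < suc k ] ∑[ h ∈ allPerms k ] H (a ∷ᶠ (punchIn a ∘ h))
∑-allPerms-suc {k} {H} H-ext = begin
  ∑[ τ ∈ allPerms (suc k) ] H τ
    ≡⟨ ∑-allPerms H ⟩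
  ∑[ f ∈ allFuns (suc k) (suc k) ] (𝟙 (isPerm? f) *ℚ H f)
    ≡⟨ ∑-allFuns-suc (λ f → 𝟙 (isPerm? f) *ℚ H f) ⟩
  ∑[ g ∈ allFuns k (suc k) ] ∑[ a < suc k ] (𝟙 (isPerm? (a ∷ᶠ g)) *ℚ H (a ∷ᶠ g))
    ≡⟨ ∑ₗ-∑-comm (allFuns k (suc k)) (suc k) (λ g a → 𝟙 (isPerm? (a ∷ᶠ g)) *ℚ H (a ∷ᶠ g)) ⟩
  ∑[ a < suc k ] ∑[ g ∈ allFuns k (suc k) ] (𝟙 (isPerm? (a ∷ᶠ g)) *ℚ H (a ∷ᶠ g))
    ≡⟨ sum-cong-≗ (λ a → ∑-allFuns-avoiding a (𝟙-isPerm-ext H-ext ∘ ∷-≗ a) (non-injective-vanishes a)) ⟩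
  ∑[ a < suc k ] ∑[ h ∈ allFuns k k ] (𝟙 (isPerm? (a ∷ᶠ (punchIn a ∘ h))) *ℚ H (a ∷ᶠ (punchIn a ∘ h)))
    ≡⟨ sum-cong-≗ (λ a → ∑ₗ-cong (allFuns k k) λ h → cong (_*ℚ H (a ∷ᶠ (punchIn a ∘ h)))
         (𝟙-⇔ (isPerm? _) (isPerm? h) (isPerm-∷-punchIn⁻ a h) (isPerm-∷-punchIn⁺ a h))) ⟩
  ∑[ a < suc k ] ∑[ h ∈ allFuns k k ] (𝟙 (isPerm? h) *ℚ H (a ∷ᶠ (punchIn a ∘ h)))
    ≡⟨ sum-cong-≗ (λ a → sym (∑-allPerms (λ h → H (a ∷ᶠ (punchIn a ∘ h))))) ⟩
  ∑[ a < suc k ] ∑[ h ∈ allPerms k ] H (a ∷ᶠ (punchIn a ∘ h)) ∎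
  where
  open ≡-Reasoning
  non-injective-vanishes : ∀ a g i → g i ≡ a → 𝟙 (isPerm? (a ∷ᶠ g)) *ℚ H (a ∷ᶠ g) ≡ 0ℚ
  non-injective-vanishes a g i gi≡a =
    trans (cong (_*ℚ H (a ∷ᶠ g)) (𝟙-no (isPerm? (a ∷ᶠ g)) λ perm → 0≢1+n (perm zero (suc i) (sym gi≡a))))
          (ℚₚ.*-zeroˡ (H (a ∷ᶠ g)))

∑-allPerms-const : ∀ k c → ∑[ τ ∈ allPerms k ] c ≡ (k !) ×ℚ c
∑-allPerms-const zero    c = refl
∑-allPerms-const (suc k) c = begin
  ∑[ τ ∈ allPerms (suc k) ] c          ≡⟨ ∑-allPerms-suc {k} {λ _ → c} (λ _ → refl) ⟩
  ∑[ a < suc k ] ∑[ h ∈ allPerms k ] c ≡⟨ sum-cong-≗ {suc k} (λ _ → ∑-allPerms-const k c) ⟩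
  ∑[ a < suc k ] ((k !) ×ℚ c)          ≡⟨ sum-replicate (suc k) {(k !) ×ℚ c} ⟩
  suc k ×ℚ ((k !) ×ℚ c)                ≡⟨ ×-assocˡ c (suc k) (k !) ⟩
  (suc k !) ×ℚ c                       ∎
  where open ≡-Reasoning

isPerm-∘ʳ⁻ : ∀ {n} {f γ : Endo n} → IsPerm γ → IsPerm (f ∘ γ) → IsPerm f
isPerm-∘ʳ⁻ {γ = γ} γ-perm fγ-perm i j fi≡fj
  with isPerm⇒surjective γ-perm i | isPerm⇒surjective γ-perm j
... | i′ , refl | j′ , refl = cong γ (fγ-perm i′ j′ fi≡fj)

∑-allPerms-∘ʳ : ∀ {n} {γ : Endo n} → IsPerm γ → {H : Endo n → ℚ} → Extensional H →
                ∑[ σ ∈ allPerms n ] H (σ ∘ γ) ≡ ∑[ σ ∈ allPerms n ] H σ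
∑-allPerms-∘ʳ {n} {γ} γ-perm {H} H-ext = begin
  ∑[ σ ∈ allPerms n ] H (σ ∘ γ)
    ≡⟨ ∑-allPerms (H ∘ (_∘ γ)) ⟩
  ∑[ f ∈ allFuns n n ] (𝟙 (isPerm? f) *ℚ H (f ∘ γ))
    ≡⟨ ∑ₗ-cong (allFuns n n) (λ f → cong (_*ℚ H (f ∘ γ))
         (𝟙-⇔ (isPerm? f) (isPerm? (f ∘ γ)) (Inj-∘ γ-perm) (isPerm-∘ʳ⁻ γ-perm))) ⟩
  ∑[ f ∈ allFuns n n ] (𝟙 (isPerm? (f ∘ γ)) *ℚ H (f ∘ γ))
    ≡⟨ ∑-allFuns-∘ʳ γ-perm (𝟙-isPerm-ext H-ext) ⟩
  ∑[ f ∈ allFuns n n ] (𝟙 (isPerm? f) *ℚ H f)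
    ≡⟨ sym (∑-allPerms H) ⟩
  ∑[ σ ∈ allPerms n ] H σ ∎
  where open ≡-Reasoning

allPerms-isPerm : ∀ n → All IsPerm (allPerms n)
allPerms-isPerm n = all-filter isPerm? (allFuns n n)

-- Sorting

Increasing : ∀ {k n} → (Fin k → Fin n) → Set
Increasing {k} f = ∀ (i j : Fin k) → i Fin.< j → f i Fin.< f j

increasing? : ∀ {k n} (f : Fin k → Fin n) → Dec (Increasing f)
increasing? f = all? (λ i → all? (λ j → (i Fin.<? j) →-dec (f i Fin.<? f j)))

Increasing-≗ : ∀ {k n} {f g : Fin k → Fin n} → f ≗ g → Increasing f → Increasing g
Increasing-≗ f≗g f-inc i j i<j = subst₂ Fin._<_ (f≗g i) (f≗g j) (f-inc i j i<j)

𝟙-increasing-ext : ∀ {k n} → Extensional (λ (f : Fin k → Fin n) → 𝟙 (increasing? f))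
𝟙-increasing-ext f≗g = 𝟙-⇔ (increasing? _) (increasing? _) (Increasing-≗ f≗g) (Increasing-≗ (sym ∘ f≗g))

IsMinimum : ∀ {k n} → (Fin k → Fin n) → Fin k → Set
IsMinimum f a = ∀ b → f a Fin.≤ f b

isMinimum? : ∀ {k n} (f : Fin k → Fin n) a → Dec (IsMinimum f a)
isMinimum? f a = all? (λ b → f a Fin.≤? f b)

minimum-exists : ∀ {k n} (f : Fin (suc k) → Fin n) → ∃ (IsMinimum f)
minimum-exists {k} {n} f =
  argmin f zero (allFin (suc k)) ,
  λ b → All.lookup (f[argmin]≤f[xs] {f = f} zero (allFin (suc k))) (∈-allFin b)
  where open Extrema (≤-totalOrder n)

minimum-unique : ∀ {k n} {f : Fin k → Fin n} → Inj f → ∀ {a b} → IsMinimum f a → IsMinimum f b → a ≡ b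
minimum-unique f-inj {a} {b} a-min b-min = f-inj a b (Finₚ.≤-antisym (a-min b) (b-min a))

module _ {k n} {f : Fin (suc k) → Fin n} (f-inj : Inj f)
         (a : Fin (suc k)) {h : Endo k} (h-perm : IsPerm h) where

  increasing-∷⁺ : IsMinimum f a × Increasing (f ∘ punchIn a ∘ h) → Increasing (f ∘ (a ∷ᶠ (punchIn a ∘ h)))
  increasing-∷⁺ (a-min , tail-inc) zero    (suc j) _         =
    Finₚ.≤∧≢⇒< (a-min (punchIn a (h j))) (punchInᵢ≢i a (h j) ∘ sym ∘ f-inj _ _)
  increasing-∷⁺ (a-min , tail-inc) (suc i) (suc j) (s≤s i<j) = tail-inc i j i<j

  increasing-∷⁻ : Increasing (f ∘ (a ∷ᶠ (punchIn a ∘ h))) → IsMinimum f a × Increasing (f ∘ punchIn a ∘ h)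
  increasing-∷⁻ inc = a-min , λ i j i<j → inc (suc i) (suc j) (s≤s i<j)
    where
    a-min : IsMinimum f a
    a-min b with a ≟ b
    ... | yes refl = Finₚ.≤-refl
    ... | no  a≢b  with isPerm⇒surjective h-perm (punchOut a≢b)
    ...   | j , hj≡b′ = subst (f a Fin.≤_) (cong f (trans (cong (punchIn a) hj≡b′) (punchIn-punchOut a≢b)))
                              (ℕₚ.<⇒≤ (inc zero (suc j) (s≤s z≤n)))

∑-isMinimum : ∀ {k n} {f : Fin (suc k) → Fin n} → Inj f → ∑[ a < suc k ] 𝟙 (isMinimum? f a) ≡ 1ℚ
∑-isMinimum {k} {f = f} f-inj with minimum-exists f
... | m , m-min = begin
  ∑[ a < suc k ] 𝟙 (isMinimum? f a)
    ≡⟨ sum-remove {i = m} (λ a → 𝟙 (isMinimum? f a)) ⟩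
  𝟙 (isMinimum? f m) + ∑[ j < k ] 𝟙 (isMinimum? f (punchIn m j))
    ≡⟨ cong₂ _+_ (𝟙-yes (isMinimum? f m) m-min) (trans (sum-cong-≗ others-vanish) (sum-replicate-zero k)) ⟩
  1ℚ + 0ℚ
    ≡⟨ ℚₚ.+-identityʳ 1ℚ ⟩
  1ℚ ∎
  where
  open ≡-Reasoning
  others-vanish : ∀ j → 𝟙 (isMinimum? f (punchIn m j)) ≡ 0ℚ
  others-vanish j = 𝟙-no (isMinimum? f _) λ min → punchInᵢ≢i m j (minimum-unique f-inj min m-min)

-- A sorting permutation starts at the position of the minimum and then sorts the rest.
∑-allPerms-sorting : ∀ {k n} {f : Fin k → Fin n} → Inj f → ∑[ τ ∈ allPerms k ] 𝟙 (increasing? (f ∘ τ)) ≡ 1ℚ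
∑-allPerms-sorting {zero}          f-inj = refl
∑-allPerms-sorting {suc k} {n} {f} f-inj = begin
  ∑[ τ ∈ allPerms (suc k) ] 𝟙 (increasing? (f ∘ τ))
    ≡⟨ ∑-allPerms-suc (λ τ≗τ′ → 𝟙-increasing-ext (cong f ∘ τ≗τ′)) ⟩
  ∑[ a < suc k ] ∑[ h ∈ allPerms k ] 𝟙 (increasing? (f ∘ (a ∷ᶠ (punchIn a ∘ h))))
    ≡⟨ sum-cong-≗ (λ a → ∑ₗ-cong-All (All.map (split a) (allPerms-isPerm k))) ⟩
  ∑[ a < suc k ] ∑[ h ∈ allPerms k ] (𝟙 (isMinimum? f a) *ℚ 𝟙 (increasing? (f ∘ punchIn a ∘ h)))
    ≡⟨ sum-cong-≗ (λ a → ∑ₗ-*ˡ (allPerms k) (𝟙 (isMinimum? f a)) (λ h → 𝟙 (increasing? (f ∘ punchIn a ∘ h)))) ⟩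
  ∑[ a < suc k ] (𝟙 (isMinimum? f a) *ℚ ∑[ h ∈ allPerms k ] 𝟙 (increasing? (f ∘ punchIn a ∘ h)))
    ≡⟨ sum-cong-≗ (λ a → trans
         (cong (𝟙 (isMinimum? f a) *ℚ_) (∑-allPerms-sorting (Inj-∘ (punchIn-injective a) f-inj)))
         (ℚₚ.*-identityʳ (𝟙 (isMinimum? f a)))) ⟩
  ∑[ a < suc k ] 𝟙 (isMinimum? f a)
    ≡⟨ ∑-isMinimum f-inj ⟩
  1ℚ ∎
  where
  open ≡-Reasoning

  split : ∀ a {h} → IsPerm h → 𝟙 (increasing? (f ∘ (a ∷ᶠ (punchIn a ∘ h))))
                                 ≡ 𝟙 (isMinimum? f a) *ℚ 𝟙 (increasing? (f ∘ punchIn a ∘ h))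
  split a {h} h-perm = trans
    (𝟙-⇔ (increasing? _) (isMinimum? f a ×-dec increasing? (f ∘ punchIn a ∘ h))
         (increasing-∷⁻ f-inj a h-perm) (increasing-∷⁺ f-inj a h-perm))
    (𝟙-× (isMinimum? f a) (increasing? (f ∘ punchIn a ∘ h)))

-- Expectations and the uniform distribution

Supported : ∀ {n} → Dist n → Set
Supported D = All (IsPerm ∘ proj₁) D

module _ {n : ℕ} (D : Dist n) where

  E-cong : Supported D → {f g : Endo n → ℚ} → (∀ π → IsPerm π → f π ≡ g π) → E D f ≡ E D g
  E-cong D-perms f≡g =
    ∑ₗ-cong-All (All.map (λ {e} π-perm → cong (proj₂ e *ℚ_) (f≡g (proj₁ e) π-perm)) D-perms)

  E-*ˡ : ∀ c (f : Endo n → ℚ) → E D (λ π → c *ℚ f π) ≡ c *ℚ E D f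
  E-*ˡ c f = trans (∑ₗ-cong D λ e → x*yz≈y*xz (proj₂ e) c (f (proj₁ e)))
                   (∑ₗ-*ˡ D c (λ e → proj₂ e *ℚ f (proj₁ e)))

  E-∑ : ∀ (l : List A) (g : A → Endo n → ℚ) → E D (λ π → ∑[ a ∈ l ] g a π) ≡ ∑[ a ∈ l ] E D (g a)
  E-∑ l g = trans (∑ₗ-cong D λ e → sym (∑ₗ-*ˡ l (proj₂ e) (λ a → g a (proj₁ e))))
                  (∑ₗ-comm D l λ e a → proj₂ e *ℚ g a (proj₁ e))

  E-const : sumℚ (map proj₂ D) ≡ 1ℚ → ∀ c → E D (λ _ → c) ≡ c
  E-const total c = begin
    ∑[ e ∈ D ] (proj₂ e *ℚ c) ≡⟨ ∑ₗ-*ʳ D c proj₂ ⟩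
    ∑ₗ D proj₂ *ℚ c           ≡⟨ cong (_*ℚ c) total ⟩
    1ℚ *ℚ c                   ≡⟨ ℚₚ.*-identityˡ c ⟩
    c                         ∎
    where open ≡-Reasoning

  Pr≡E𝟙 : ∀ {P : Endo n → Set} (P? : Decidable P) → Pr D P? ≡ E D (λ π → 𝟙 (P? π))
  Pr≡E𝟙 P? = trans (∑ₗ-filter (P? ∘ proj₁) D proj₂)
                   (∑ₗ-cong D λ e → ℚₚ.*-comm (𝟙 (P? (proj₁ e))) (proj₂ e))

1/∣_∣ : List A → ℚ
1/∣ []    ∣ = 0ℚ
1/∣ _ ∷ l ∣ = ℤ.1ℤ / suc (length l)

∑ₗ-1/∣∣ : ∀ (a : A) l → ∑[ b ∈ a ∷ l ] 1/∣ a ∷ l ∣ ≡ 1ℚ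
∑ₗ-1/∣∣ a l = trans (∑ₗ-const (a ∷ l) 1/∣ a ∷ l ∣) (trans (×-1/ (suc |l|) (suc |l|)) (n/n≡1 (suc |l|)))
  where
  |l| : ℕ
  |l| = length l

avg-map : ∀ (f : A → ℚ) l → avg (map f l) ≡ ∑ₗ l f *ℚ 1/∣ l ∣
avg-map f []      = sym (ℚₚ.*-zeroʳ 0ℚ)
avg-map f (a ∷ l) = cong (λ m → ∑ₗ (a ∷ l) f *ℚ (ℤ.1ℤ / suc m)) (length-map f l)

-- The identity is sorted by exactly one permutation.
allPerms-nonempty : ∀ n → ∃₂ λ σ σs → allPerms n ≡ σ ∷ σs
allPerms-nonempty n with allPerms n | ∑-allPerms-sorting {f = λ (i : Fin n) → i} (λ _ _ i≡j → i≡j)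
... | []     | ()
... | σ ∷ σs | _ = σ , σs , refl

uniform : ∀ n → Dist n
uniform n = map (λ σ → σ , 1/∣ allPerms n ∣) (allPerms n)

uniform-supported : ∀ n → Supported (uniform n)
uniform-supported n = map⁺ (allPerms-isPerm n)

uniform-total : ∀ n → sumℚ (map proj₂ (uniform n)) ≡ 1ℚ
uniform-total n with allPerms-nonempty n
... | σ , σs , perms≡ = trans (∑ₗ-map _ (allPerms n) proj₂)
                              (subst (λ l → ∑[ τ ∈ l ] 1/∣ l ∣ ≡ 1ℚ) (sym perms≡) (∑ₗ-1/∣∣ σ σs))

E-uniform : ∀ n (f : Endo n → ℚ) → E (uniform n) f ≡ 1/∣ allPerms n ∣ *ℚ ∑[ σ ∈ allPerms n ] f σ
E-uniform n f = trans (∑ₗ-map _ (allPerms n) _) (∑ₗ-*ˡ (allPerms n) 1/∣ allPerms n ∣ f)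

EUnif≡E-uniform : ∀ n (f : Endo n → ℚ) → EUnif n f ≡ E (uniform n) f
EUnif≡E-uniform n f =
  trans (avg-map f (allPerms n))
        (trans (ℚₚ.*-comm (∑ₗ (allPerms n) f) 1/∣ allPerms n ∣) (sym (E-uniform n f)))

E-uniform-∘ʳ : ∀ {n} {γ : Endo n} → IsPerm γ → {H : Endo n → ℚ} → Extensional H →
               E (uniform n) (λ σ → H (σ ∘ γ)) ≡ E (uniform n) H
E-uniform-∘ʳ {n} γ-perm {H} H-ext = trans (E-uniform n _)
  (trans (cong (1/∣ allPerms n ∣ *ℚ_) (∑-allPerms-∘ʳ γ-perm H-ext)) (sym (E-uniform n H)))

E-uniform-exchangeable : ∀ {m n} {u v : Fin m → Fin n} → Inj u → Inj v →
                         {G : (Fin m → Fin n) → ℚ} → Extensional G →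
                         E (uniform n) (λ σ → G (σ ∘ u)) ≡ E (uniform n) (λ σ → G (σ ∘ v))
E-uniform-exchangeable {n = n} {u} {v} u-inj v-inj {G} G-ext with extend-injection u v u-inj v-inj
... | γ , γ-perm , γu≡v = begin
  E (uniform n) (λ σ → G (σ ∘ u))
    ≡⟨ E-uniform-∘ʳ γ-perm (λ σ≗σ′ → G-ext (σ≗σ′ ∘ u)) ⟨
  E (uniform n) (λ σ → G (σ ∘ γ ∘ u))
    ≡⟨ E-cong (uniform n) (uniform-supported n) (λ σ _ → G-ext (cong σ ∘ γu≡v)) ⟩
  E (uniform n) (λ σ → G (σ ∘ v)) ∎
  where open ≡-Reasoning

module _ {k n} {y : Fin k → Fin n} (y-inj : Inj y) where

  private instance
    k!≢0 : NonZero (k !)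
    k!≢0 = k ℕₚ.!≢0

  Pr-uniform-relabel : ∀ {τ : Endo k} → IsPerm τ →
                       Pr (uniform n) (inducedOrder? (y ∘ τ)) ≡ Pr (uniform n) (inducedOrder? y)
  Pr-uniform-relabel {τ} τ-perm = begin
    Pr (uniform n) (inducedOrder? (y ∘ τ))
      ≡⟨ Pr≡E𝟙 (uniform n) (inducedOrder? (y ∘ τ)) ⟩
    E (uniform n) (λ σ → 𝟙 (increasing? (σ ∘ y ∘ τ)))
      ≡⟨ E-uniform-exchangeable (Inj-∘ τ-perm y-inj) y-inj 𝟙-increasing-ext ⟩
    E (uniform n) (λ σ → 𝟙 (increasing? (σ ∘ y)))
      ≡⟨ Pr≡E𝟙 (uniform n) (inducedOrder? y) ⟨
    Pr (uniform n) (inducedOrder? y) ∎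
    where open ≡-Reasoning

  ∑-Pr-uniform-relabel : ∑[ τ ∈ allPerms k ] Pr (uniform n) (inducedOrder? (y ∘ τ)) ≡ 1ℚ
  ∑-Pr-uniform-relabel = begin
    ∑[ τ ∈ allPerms k ] Pr (uniform n) (inducedOrder? (y ∘ τ))
      ≡⟨ ∑ₗ-cong (allPerms k) (λ τ → Pr≡E𝟙 (uniform n) (inducedOrder? (y ∘ τ))) ⟩
    ∑[ τ ∈ allPerms k ] E (uniform n) (λ σ → 𝟙 (inducedOrder? (y ∘ τ) σ))
      ≡⟨ sym (E-∑ (uniform n) (allPerms k) (λ τ σ → 𝟙 (inducedOrder? (y ∘ τ) σ))) ⟩
    E (uniform n) (λ σ → ∑[ τ ∈ allPerms k ] 𝟙 (inducedOrder? (y ∘ τ) σ))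
      ≡⟨ E-cong (uniform n) (uniform-supported n) (λ σ σ-perm → ∑-allPerms-sorting (Inj-∘ y-inj σ-perm)) ⟩
    E (uniform n) (λ _ → 1ℚ)
      ≡⟨ E-const (uniform n) (uniform-total n) 1ℚ ⟩
    1ℚ ∎
    where open ≡-Reasoning

  -- The k! relabellings y ∘ τ are equally likely and exactly one of them is sorted.
  Pr-uniform-inducedOrder : Pr (uniform n) (inducedOrder? y) ≡ ℤ.1ℤ / (k !)
  Pr-uniform-inducedOrder = ×-cancelˡ (k !) (begin
    (k !) ×ℚ Pr (uniform n) (inducedOrder? y)
      ≡⟨ ∑-allPerms-const k _ ⟨
    ∑[ τ ∈ allPerms k ] Pr (uniform n) (inducedOrder? y)
      ≡⟨ ∑ₗ-cong-All (All.map Pr-uniform-relabel (allPerms-isPerm k)) ⟨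
    ∑[ τ ∈ allPerms k ] Pr (uniform n) (inducedOrder? (y ∘ τ))
      ≡⟨ ∑-Pr-uniform-relabel ⟩
    1ℚ
      ≡⟨ n/n≡1 (k !) ⟨
    ℤ.+ (k !) / (k !)
      ≡⟨ ×-1/ (k !) (k !) ⟨
    (k !) ×ℚ (ℤ.1ℤ / (k !)) ∎)
    where open ≡-Reasoning

-- Order classes

Constraints : ℕ → Set
Constraints n = List (Fin n × Fin n)

Satisfies : ∀ {n} → Constraints n → Endo n → Set
Satisfies C π = All (λ c → π (proj₁ c) Fin.≤ π (proj₂ c)) C

satisfies? : ∀ {n} (C : Constraints n) (π : Endo n) → Dec (Satisfies C π)
satisfies? C π = All.all? (λ c → π (proj₁ c) Fin.≤? π (proj₂ c)) C

endpoints : ∀ {n} → Constraints n → List (Fin n)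
endpoints []            = []
endpoints ((u , v) ∷ C) = u ∷ v ∷ endpoints C

length-endpoints : ∀ {n} (C : Constraints n) → length (endpoints C) ≡ 2 * length C
length-endpoints []      = refl
length-endpoints (_ ∷ C) =
  trans (cong (λ m → suc (suc m)) (length-endpoints C)) (sym (ℕₚ.*-suc 2 (length C)))

Satisfies-transfer : ∀ {k n} {y : Fin k → Fin n} {π ρ : Endo n} →
                     (∀ i j → π (y i) Fin.≤ π (y j) → ρ (y i) Fin.≤ ρ (y j)) →
                     ∀ C → Covers y (endpoints C) → Satisfies C π → Satisfies C ρ
Satisfies-transfer same-order []            []                                  []        = []
Satisfies-transfer same-order ((u , v) ∷ C) ((i , refl) ∷ (j , refl) ∷ covers) (u≤v ∷ sat) =
  same-order i j u≤v ∷ Satisfies-transfer same-order C covers sat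

module _ {k n} {f : Fin k → Fin n} (f-inc : Increasing f) where

  Increasing-reflects-≤ : ∀ {i j} → f i Fin.≤ f j → i Fin.≤ j
  Increasing-reflects-≤ fi≤fj = ℕₚ.≮⇒≥ (λ j<i → ℕₚ.<⇒≱ (f-inc _ _ j<i) fi≤fj)

  Increasing-preserves-≤ : ∀ {i j} → i Fin.≤ j → f i Fin.≤ f j
  Increasing-preserves-≤ {i} {j} i≤j with Finₚ.<-cmp i j
  ... | tri< i<j _ _ = ℕₚ.<⇒≤ (f-inc i j i<j)
  ... | tri≈ _ refl _ = Finₚ.≤-refl
  ... | tri> _ _ j<i = contradiction i≤j (ℕₚ.<⇒≱ j<i)

inducedOrder-≤-transfer : ∀ {k n} {y : Fin k → Fin n} {τ : Endo k} {π ρ : Endo n} → IsPerm τ →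
            InducedOrder (y ∘ τ) π → InducedOrder (y ∘ τ) ρ →
            ∀ i j → π (y i) Fin.≤ π (y j) → ρ (y i) Fin.≤ ρ (y j)
inducedOrder-≤-transfer τ-perm π-ord ρ-ord i j πi≤πj
  with isPerm⇒surjective τ-perm i | isPerm⇒surjective τ-perm j
... | a , refl | b , refl = Increasing-preserves-≤ ρ-ord (Increasing-reflects-≤ π-ord πi≤πj)

ind : ∀ {n} → Constraints n → Endo n → ℚ
ind C π = 𝟙 (satisfies? C π)

-- ind C is constant on each class {π : π ∘ y ∘ τ increasing}, because the endpoints of C
-- lie in the image of y; classValue τ is its value at a representative of the class.
module OrderClasses {k n} (k≤n : k ≤ n) {y : Fin k → Fin n} (y-inj : Inj y)
                    (C : Constraints n) (covers : Covers y (endpoints C)) where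

  private
    ι : Fin k → Fin n
    ι i = inject≤ i k≤n

    sorter : ∀ {τ : Endo k} → IsPerm τ → ∃ λ (ρ : Endo n) → IsPerm ρ × (∀ i → ρ (y (τ i)) ≡ ι i)
    sorter τ-perm = extend-injection _ ι (Inj-∘ τ-perm y-inj) (inject≤-injective k≤n k≤n)

  representative : ∀ {τ : Endo k} → IsPerm τ → Endo n
  representative τ-perm = proj₁ (sorter τ-perm)

  representative-inducedOrder : ∀ {τ} (τ-perm : IsPerm τ) → InducedOrder (y ∘ τ) (representative τ-perm)
  representative-inducedOrder {τ} τ-perm i j i<j =
    subst₂ ℕ._<_ (sym (trans (cong toℕ (ρyτ≡ι i)) (toℕ-inject≤ i k≤n)))
                 (sym (trans (cong toℕ (ρyτ≡ι j)) (toℕ-inject≤ j k≤n))) i<j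
    where
    ρyτ≡ι : ∀ i → representative τ-perm (y (τ i)) ≡ ι i
    ρyτ≡ι = proj₂ (proj₂ (sorter τ-perm))

  classValue : Endo k → ℚ
  classValue τ with isPerm? τ
  ... | yes τ-perm = ind C (representative τ-perm)
  ... | no  _      = 0ℚ

  classValue-nonNeg : ∀ τ → 0ℚ ≤ℚ classValue τ
  classValue-nonNeg τ with isPerm? τ
  ... | yes τ-perm = 𝟙-nonNeg (satisfies? C (representative τ-perm))
  ... | no  _      = ℚₚ.≤-refl

  ind≡classValue : ∀ {τ} → IsPerm τ → ∀ {π} → InducedOrder (y ∘ τ) π → ind C π ≡ classValue τ
  ind≡classValue {τ} τ-perm′ {π} π-ord with isPerm? τ
  ... | no ¬τ-perm = contradiction τ-perm′ ¬τ-perm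
  ... | yes τ-perm = 𝟙-⇔ (satisfies? C π) (satisfies? C ρ)
    (Satisfies-transfer (inducedOrder-≤-transfer {π = π} {ρ} τ-perm π-ord ρ-ord) C covers)
    (Satisfies-transfer (inducedOrder-≤-transfer {π = ρ} {π} τ-perm ρ-ord π-ord) C covers)
    where
    ρ : Endo n
    ρ = representative τ-perm

    ρ-ord : InducedOrder (y ∘ τ) ρ
    ρ-ord = representative-inducedOrder τ-perm

  ind-decomposition : ∀ {π} → IsPerm π →
                      ind C π ≡ ∑[ τ ∈ allPerms k ] (classValue τ *ℚ 𝟙 (inducedOrder? (y ∘ τ) π))
  ind-decomposition {π} π-perm = begin
    ind C π
      ≡⟨ sym (ℚₚ.*-identityʳ (ind C π)) ⟩
    ind C π *ℚ 1ℚ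
      ≡⟨ cong (ind C π *ℚ_) (sym (∑-allPerms-sorting (Inj-∘ y-inj π-perm))) ⟩
    ind C π *ℚ ∑[ τ ∈ allPerms k ] 𝟙 (inducedOrder? (y ∘ τ) π)
      ≡⟨ sym (∑ₗ-*ˡ (allPerms k) (ind C π) (λ τ → 𝟙 (inducedOrder? (y ∘ τ) π))) ⟩
    ∑[ τ ∈ allPerms k ] (ind C π *ℚ 𝟙 (inducedOrder? (y ∘ τ) π))
      ≡⟨ ∑ₗ-cong-All (All.map (λ τ-perm → *-𝟙-cong (inducedOrder? _ π) (ind≡classValue τ-perm))
                              (allPerms-isPerm k)) ⟩
    ∑[ τ ∈ allPerms k ] (classValue τ *ℚ 𝟙 (inducedOrder? (y ∘ τ) π)) ∎
    where open ≡-Reasoning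

  E-ind-decomposition : ∀ (D : Dist n) → Supported D →
                        E D (ind C) ≡ ∑[ τ ∈ allPerms k ] (classValue τ *ℚ Pr D (inducedOrder? (y ∘ τ)))
  E-ind-decomposition D D-supp = begin
    E D (ind C)
      ≡⟨ E-cong D D-supp (λ π → ind-decomposition) ⟩
    E D (λ π → ∑[ τ ∈ allPerms k ] (classValue τ *ℚ 𝟙 (inducedOrder? (y ∘ τ) π)))
      ≡⟨ E-∑ D (allPerms k) (λ τ π → classValue τ *ℚ 𝟙 (inducedOrder? (y ∘ τ) π)) ⟩
    ∑[ τ ∈ allPerms k ] E D (λ π → classValue τ *ℚ 𝟙 (inducedOrder? (y ∘ τ) π))
      ≡⟨ ∑ₗ-cong (allPerms k) (λ τ → trans (E-*ˡ D (classValue τ) _)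
                                       (cong (classValue τ *ℚ_) (sym (Pr≡E𝟙 D (inducedOrder? (y ∘ τ)))))) ⟩
    ∑[ τ ∈ allPerms k ] (classValue τ *ℚ Pr D (inducedOrder? (y ∘ τ))) ∎
    where open ≡-Reasoning

Monomial : ℕ → Set
Monomial n = ℚ × Constraints n

eval : ∀ {n} → List (Monomial n) → Endo n → ℚ
eval P π = ∑[ t ∈ P ] (proj₁ t *ℚ ind (proj₂ t) π)

E-eval : ∀ {n} (D : Dist n) (P : List (Monomial n)) →
         E D (eval P) ≡ ∑[ t ∈ P ] (proj₁ t *ℚ E D (ind (proj₂ t)))
E-eval D P = trans (E-∑ D P (λ t π → proj₁ t *ℚ ind (proj₂ t) π))
                   (∑ₗ-cong P λ t → E-*ˡ D (proj₁ t) (ind (proj₂ t)))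

module _ {n k : ℕ} {δ : ℚ} {D : Dist n} (k≤n : k ≤ n) (uio : UIO k δ D) (D-supp : Supported D) where

  private instance
    k!≢0 : NonZero (k !)
    k!≢0 = k ℕₚ.!≢0

  dominated-ind : ∀ C → length (endpoints C) ≤ k → (1ℚ - δ) *ℚ E (uniform n) (ind C) ≤ℚ E D (ind C)
  dominated-ind C |C|≤k with cover-by-injection (endpoints C) |C|≤k k≤n
  ... | y , y-inj , covers = begin
    (1ℚ - δ) *ℚ E (uniform n) (ind C)
      ≡⟨ cong ((1ℚ - δ) *ℚ_) (E-ind-decomposition (uniform n) (uniform-supported n)) ⟩
    (1ℚ - δ) *ℚ ∑[ τ ∈ allPerms k ] (classValue τ *ℚ Pr (uniform n) (inducedOrder? (y ∘ τ)))
      ≤⟨ ∑ₗ-scaled-mono (allPerms k) (1ℚ - δ) (All.map class-bound (allPerms-isPerm k)) ⟩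
    ∑[ τ ∈ allPerms k ] (classValue τ *ℚ Pr D (inducedOrder? (y ∘ τ)))
      ≡⟨ E-ind-decomposition D D-supp ⟨
    E D (ind C) ∎
    where
    open OrderClasses k≤n y-inj C covers
    open ℚₚ.≤-Reasoning

    class-bound : ∀ {τ} → IsPerm τ → 0ℚ ≤ℚ classValue τ ×
                  (1ℚ - δ) *ℚ Pr (uniform n) (inducedOrder? (y ∘ τ)) ≤ℚ Pr D (inducedOrder? (y ∘ τ))
    class-bound {τ} τ-perm =
      classValue-nonNeg τ ,
      subst (λ p → (1ℚ - δ) *ℚ p ≤ℚ Pr D (inducedOrder? (y ∘ τ)))
            (sym (Pr-uniform-inducedOrder (Inj-∘ τ-perm y-inj))) (uio (y ∘ τ) (Inj-∘ τ-perm y-inj))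

  dominated-eval : ∀ P → All (λ t → 0ℚ ≤ℚ proj₁ t × length (endpoints (proj₂ t)) ≤ k) P →
                   (1ℚ - δ) *ℚ E (uniform n) (eval P) ≤ℚ E D (eval P)
  dominated-eval P admissible = begin
    (1ℚ - δ) *ℚ E (uniform n) (eval P)
      ≡⟨ cong ((1ℚ - δ) *ℚ_) (E-eval (uniform n) P) ⟩
    (1ℚ - δ) *ℚ ∑[ t ∈ P ] (proj₁ t *ℚ E (uniform n) (ind (proj₂ t)))
      ≤⟨ ∑ₗ-scaled-mono P (1ℚ - δ) {proj₁} {E (uniform n) ∘ ind ∘ proj₂} {E D ∘ ind ∘ proj₂}
                        (All.map (λ {t} → bound t) admissible) ⟩
    ∑[ t ∈ P ] (proj₁ t *ℚ E D (ind (proj₂ t)))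
      ≡⟨ E-eval D P ⟨
    E D (eval P) ∎
    where
    open ℚₚ.≤-Reasoning
    bound : ∀ t → 0ℚ ≤ℚ proj₁ t × length (endpoints (proj₂ t)) ≤ k →
            0ℚ ≤ℚ proj₁ t × (1ℚ - δ) *ℚ E (uniform n) (ind (proj₂ t)) ≤ℚ E D (ind (proj₂ t))
    bound (c , C) (0≤c , |C|≤k) = 0≤c , dominated-ind C |C|≤k

-- Expanding the monomial

∑-𝟙-≤ : ∀ {m} (a : Fin m) q → ∑[ v < m ] (𝟙 (v Fin.≤? a) *ℚ q) ≡ suc (toℕ a) ×ℚ q
∑-𝟙-≤ {suc m} zero q =
  cong₂ _+_ (ℚₚ.*-identityˡ q) (trans (sum-cong-≗ {m} above-zero) (sum-replicate-zero m))
  where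
  above-zero : ∀ v → 𝟙 (suc v Fin.≤? zero {n = m}) *ℚ q ≡ 0ℚ
  above-zero v = ℚₚ.*-zeroˡ q
∑-𝟙-≤ {suc m} (suc a) q = cong₂ _+_ (ℚₚ.*-identityˡ q) (trans (sum-cong-≗ {m} shift) (∑-𝟙-≤ a q))
  where
  shift : ∀ v → 𝟙 (suc v Fin.≤? suc a) *ℚ q ≡ 𝟙 (v Fin.≤? a) *ℚ q
  shift v = cong (_*ℚ q) (𝟙-⇔ (suc v Fin.≤? suc a) (v Fin.≤? a) ℕₚ.≤-pred s≤s)

degree : ∀ p → (Fin p → ℕ) → ℕ
degree zero    ks = 0
degree (suc p) ks = ks zero ℕ.+ degree p (ks ∘ suc)

degree-*ˡ : ∀ p c (ks : Fin p → ℕ) → degree p (λ i → c * ks i) ≡ c * degree p ks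
degree-*ˡ zero    c ks = sym (ℕₚ.*-zeroʳ c)
degree-*ˡ (suc p) c ks =
  trans (cong (c * ks zero ℕ.+_) (degree-*ˡ p c (ks ∘ suc))) (sym (ℕₚ.*-distribˡ-+ c _ _))

degree-bounded : ∀ p {ks : Fin p → ℕ} {B} → (∀ i → ks i ≤ B) → degree p ks ≤ p * B
degree-bounded zero    ks≤B = z≤n
degree-bounded (suc p) ks≤B = ℕₚ.+-mono-≤ (ks≤B zero) (degree-bounded p (ks≤B ∘ suc))

twice-degree≤ : ∀ p {ks : Fin p → ℕ} {k} → (∀ i → 2 * p * ks i ≤ k) → 2 * degree p ks ≤ k
twice-degree≤ zero          small = z≤n
twice-degree≤ (suc p) {ks} {k} small = ℕₚ.*-cancelˡ-≤ (suc p) (begin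
  suc p * (2 * degree (suc p) ks)           ≡⟨ ℕₚ.*-assoc (suc p) 2 (degree (suc p) ks) ⟨
  suc p * 2 * degree (suc p) ks             ≡⟨ cong (_* degree (suc p) ks) (ℕₚ.*-comm (suc p) 2) ⟩
  2 * suc p * degree (suc p) ks             ≡⟨ degree-*ˡ (suc p) (2 * suc p) ks ⟨
  degree (suc p) (λ i → 2 * suc p * ks i)   ≤⟨ degree-bounded (suc p) small ⟩
  suc p * k                                 ∎)
  where open ℕₚ.≤-Reasoning

prodFin-cong : ∀ p {f g : Fin p → ℚ} → f ≗ g → prodFin p f ≡ prodFin p g
prodFin-cong zero    f≗g = refl
prodFin-cong (suc p) f≗g = cong₂ _*ℚ_ (f≗g zero) (prodFin-cong p (f≗g ∘ suc))

module Expansion {n : ℕ} {{_ : NonZero n}} where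

  1/n : ℚ
  1/n = ℤ.1ℤ / n

  scaled : Fin n → ℚ
  scaled v = ℤ.+ suc (toℕ v) / n

  scaledMonomial : ∀ {p} → (Fin p → ℕ) → (Fin p → Fin n) → ℚ
  scaledMonomial {p} ks f = prodFin p (λ i → scaled (f i) ^ℚ ks i)

  scaledMonomial-ext : ∀ {p} (ks : Fin p → ℕ) → Extensional (scaledMonomial ks)
  scaledMonomial-ext {p} ks f≗g = prodFin-cong p (λ i → cong (λ v → scaled v ^ℚ ks i) (f≗g i))

  scaledPos-as-count : ∀ {π : Endo n} → IsPerm π → ∀ x →
                       ∑[ j ∈ allFin n ] (𝟙 (π j Fin.≤? π x) *ℚ 1/n) ≡ scaledPos π x
  scaledPos-as-count {π} π-perm x = begin
    ∑[ j ∈ allFin n ] (𝟙 (π j Fin.≤? π x) *ℚ 1/n)   ≡⟨ ∑ₗ-allFin n (λ j → 𝟙 (π j Fin.≤? π x) *ℚ 1/n) ⟩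
    ∑[ j < n ] (𝟙 (π j Fin.≤? π x) *ℚ 1/n)          ≡⟨ ∑-reindex π-perm (λ v → 𝟙 (v Fin.≤? π x) *ℚ 1/n) ⟩
    ∑[ v < n ] (𝟙 (v Fin.≤? π x) *ℚ 1/n)            ≡⟨ ∑-𝟙-≤ (π x) 1/n ⟩
    suc (toℕ (π x)) ×ℚ 1/n                          ≡⟨ ×-1/ (suc (toℕ (π x))) n ⟩
    scaledPos π x                                   ∎
    where open ≡-Reasoning

  times-scaledPos : List (Monomial n) → Fin n → List (Monomial n)
  times-scaledPos P x = concatMap (λ t → map (λ j → proj₁ t *ℚ 1/n , (j , x) ∷ proj₂ t) (allFin n)) P

  eval-times-scaledPos : ∀ P x {π : Endo n} → IsPerm π →
                         eval (times-scaledPos P x) π ≡ eval P π *ℚ scaledPos π x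
  eval-times-scaledPos P x {π} π-perm = begin
    eval (times-scaledPos P x) π
      ≡⟨ ∑ₗ-concatMap _ P (λ t → proj₁ t *ℚ ind (proj₂ t) π) ⟩
    ∑[ t ∈ P ] ∑[ t′ ∈ map (λ j → proj₁ t *ℚ 1/n , (j , x) ∷ proj₂ t) (allFin n) ] (proj₁ t′ *ℚ ind (proj₂ t′) π)
      ≡⟨ ∑ₗ-cong P (λ t → trans (∑ₗ-map _ (allFin n) _) (∑ₗ-cong (allFin n) (split t))) ⟩
    ∑[ t ∈ P ] ∑[ j ∈ allFin n ] ((proj₁ t *ℚ ind (proj₂ t) π) *ℚ (𝟙 (π j Fin.≤? π x) *ℚ 1/n))
      ≡⟨ ∑ₗ-cong P (λ t → ∑ₗ-*ˡ (allFin n) (proj₁ t *ℚ ind (proj₂ t) π) (λ j → 𝟙 (π j Fin.≤? π x) *ℚ 1/n)) ⟩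
    ∑[ t ∈ P ] ((proj₁ t *ℚ ind (proj₂ t) π) *ℚ ∑[ j ∈ allFin n ] (𝟙 (π j Fin.≤? π x) *ℚ 1/n))
      ≡⟨ ∑ₗ-cong P (λ t → cong ((proj₁ t *ℚ ind (proj₂ t) π) *ℚ_) (scaledPos-as-count π-perm x)) ⟩
    ∑[ t ∈ P ] ((proj₁ t *ℚ ind (proj₂ t) π) *ℚ scaledPos π x)
      ≡⟨ ∑ₗ-*ʳ P (scaledPos π x) (λ t → proj₁ t *ℚ ind (proj₂ t) π) ⟩
    eval P π *ℚ scaledPos π x ∎
    where
    open ≡-Reasoning
    split : ∀ t j → (proj₁ t *ℚ 1/n) *ℚ ind ((j , x) ∷ proj₂ t) π
                      ≡ (proj₁ t *ℚ ind (proj₂ t) π) *ℚ (𝟙 (π j Fin.≤? π x) *ℚ 1/n)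
    split (c , C) j = begin
      (c *ℚ 1/n) *ℚ ind ((j , x) ∷ C) π        ≡⟨ cong ((c *ℚ 1/n) *ℚ_) (𝟙-× (π j Fin.≤? π x) (satisfies? C π)) ⟩
      (c *ℚ 1/n) *ℚ (a *ℚ ind C π)             ≡⟨ *-interchange c 1/n a (ind C π) ⟩
      (c *ℚ a) *ℚ (1/n *ℚ ind C π)             ≡⟨ cong ((c *ℚ a) *ℚ_) (ℚₚ.*-comm 1/n (ind C π)) ⟩
      (c *ℚ a) *ℚ (ind C π *ℚ 1/n)             ≡⟨ *-interchange c (ind C π) a 1/n ⟨
      (c *ℚ ind C π) *ℚ (a *ℚ 1/n)             ∎
      where
      a : ℚ
      a = 𝟙 (π j Fin.≤? π x)

  times-scaledPos^ : List (Monomial n) → Fin n → ℕ → List (Monomial n)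
  times-scaledPos^ P x zero    = P
  times-scaledPos^ P x (suc m) = times-scaledPos (times-scaledPos^ P x m) x

  eval-times-scaledPos^ : ∀ P x m {π : Endo n} → IsPerm π →
                          eval (times-scaledPos^ P x m) π ≡ eval P π *ℚ (scaledPos π x ^ℚ m)
  eval-times-scaledPos^ P x zero    π-perm = sym (ℚₚ.*-identityʳ (eval P _))
  eval-times-scaledPos^ P x (suc m) {π} π-perm = begin
    eval (times-scaledPos^ P x (suc m)) π
      ≡⟨ eval-times-scaledPos (times-scaledPos^ P x m) x π-perm ⟩
    eval (times-scaledPos^ P x m) π *ℚ scaledPos π x
      ≡⟨ cong (_*ℚ scaledPos π x) (eval-times-scaledPos^ P x m π-perm) ⟩
    eval P π *ℚ (scaledPos π x ^ℚ m) *ℚ scaledPos π x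
      ≡⟨ xy*z≈x*zy (eval P π) (scaledPos π x ^ℚ m) (scaledPos π x) ⟩
    eval P π *ℚ (scaledPos π x *ℚ (scaledPos π x ^ℚ m)) ∎
    where open ≡-Reasoning

  expand : ∀ p → (Fin p → Fin n) → (Fin p → ℕ) → List (Monomial n)
  expand zero    x ks = (1ℚ , []) ∷ []
  expand (suc p) x ks = times-scaledPos^ (expand p (x ∘ suc) (ks ∘ suc)) (x zero) (ks zero)

  eval-expand : ∀ p x ks {π : Endo n} → IsPerm π →
                eval (expand p x ks) π ≡ scaledMonomial ks (π ∘ x)
  eval-expand zero    x ks π-perm = refl
  eval-expand (suc p) x ks {π} π-perm = begin
    eval (expand (suc p) x ks) π
      ≡⟨ eval-times-scaledPos^ (expand p (x ∘ suc) (ks ∘ suc)) (x zero) (ks zero) π-perm ⟩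
    eval (expand p (x ∘ suc) (ks ∘ suc)) π *ℚ (scaledPos π (x zero) ^ℚ ks zero)
      ≡⟨ cong (_*ℚ (scaledPos π (x zero) ^ℚ ks zero)) (eval-expand p (x ∘ suc) (ks ∘ suc) π-perm) ⟩
    prodFin p (λ i → scaledPos π (x (suc i)) ^ℚ ks (suc i)) *ℚ (scaledPos π (x zero) ^ℚ ks zero)
      ≡⟨ ℚₚ.*-comm (prodFin p (λ i → scaledPos π (x (suc i)) ^ℚ ks (suc i))) _ ⟩
    prodFin (suc p) (λ i → scaledPos π (x i) ^ℚ ks i) ∎
    where open ≡-Reasoning

  Shape : ℕ → List (Monomial n) → Set
  Shape L = All (λ t → 0ℚ ≤ℚ proj₁ t × length (proj₂ t) ≡ L)

  times-scaledPos-shape : ∀ {L} P x → Shape L P → Shape (suc L) (times-scaledPos P x)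
  times-scaledPos-shape []      x []                     = []
  times-scaledPos-shape (t ∷ P) x ((0≤c , |C|≡L) ∷ shape) =
    ++⁺ (map⁺ (tabulate⁺ λ j → 0≤c/n , cong suc |C|≡L)) (times-scaledPos-shape P x shape)
    where
    0≤c/n : 0ℚ ≤ℚ proj₁ t *ℚ 1/n
    0≤c/n = ℚₚ.nonNegative⁻¹ _
      {{ℚₚ.nonNeg*nonNeg⇒nonNeg (proj₁ t) {{ℚ.nonNegative 0≤c}} 1/n {{ℚₚ.normalize-nonNeg 1 n}}}}

  times-scaledPos^-shape : ∀ {L} P x m → Shape L P → Shape (m ℕ.+ L) (times-scaledPos^ P x m)
  times-scaledPos^-shape P x zero    shape = shape
  times-scaledPos^-shape P x (suc m) shape = times-scaledPos-shape _ x (times-scaledPos^-shape P x m shape)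

  expand-shape : ∀ p x ks → Shape (degree p ks) (expand p x ks)
  expand-shape zero    x ks = (ℚₚ.nonNegative⁻¹ 1ℚ , refl) ∷ []
  expand-shape (suc p) x ks =
    times-scaledPos^-shape _ (x zero) (ks zero) (expand-shape p (x ∘ suc) (ks ∘ suc))

  expand-admissible : ∀ {p k} (x : Fin p → Fin n) {ks : Fin p → ℕ} → (∀ i → 2 * p * ks i ≤ k) →
                      All (λ t → 0ℚ ≤ℚ proj₁ t × length (endpoints (proj₂ t)) ≤ k) (expand p x ks)
  expand-admissible {p} {k} x {ks} ks-small = All.map (λ {t} → admissible t) (expand-shape p x ks)
    where
    admissible : ∀ t → 0ℚ ≤ℚ proj₁ t × length (proj₂ t) ≡ degree p ks →
                 0ℚ ≤ℚ proj₁ t × length (endpoints (proj₂ t)) ≤ k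
    admissible (c , C) (0≤c , |C|≡d) = 0≤c , ℕₚ.≤-trans
      (ℕₚ.≤-reflexive (trans (length-endpoints C) (cong (2 *_) |C|≡d))) (twice-degree≤ p ks-small)

mainTheorem4 : (n k p : ℕ) → {{_ : NonZero n}} → 1 ≤ k → k ≤ n →
    (δ : ℚ) → 0ℚ ≤ℚ δ → δ ≤ℚ 1ℚ →
    (D : Dist n) → IsDist D → UIO k δ D →
    (x : Fin p → Fin n) → (∀ i j → x i ≡ x j → i ≡ j) → (p≤n : p ≤ n) →
    (ks : Fin p → ℕ) → (∀ i → 2 * p * ks i ≤ k) →
    (1ℚ - δ) *ℚ EUnif n (λ σ → prodFin p (λ i → scaledPos σ (inject≤ i p≤n) ^ℚ ks i))
    ≤ℚ E D (λ π → prodFin p (λ i → scaledPos π (x i) ^ℚ ks i))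
mainTheorem4 n k p _ k≤n δ _ _ D D-dist uio x x-inj p≤n ks ks-small = begin
  (1ℚ - δ) *ℚ EUnif n (λ σ → scaledMonomial ks (σ ∘ ι))
    ≡⟨ cong ((1ℚ - δ) *ℚ_) (EUnif≡E-uniform n _) ⟩
  (1ℚ - δ) *ℚ E (uniform n) (λ σ → scaledMonomial ks (σ ∘ ι))
    ≡⟨ cong ((1ℚ - δ) *ℚ_) (E-uniform-exchangeable ι-inj x-inj (scaledMonomial-ext ks)) ⟩
  (1ℚ - δ) *ℚ E (uniform n) (λ σ → scaledMonomial ks (σ ∘ x))
    ≡⟨ cong ((1ℚ - δ) *ℚ_) (E-cong (uniform n) (uniform-supported n) (λ π → eval-expand p x ks)) ⟨
  (1ℚ - δ) *ℚ E (uniform n) (eval (expand p x ks))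
    ≤⟨ dominated-eval {δ = δ} k≤n uio D-supp (expand p x ks) (expand-admissible x ks-small) ⟩
  E D (eval (expand p x ks))
    ≡⟨ E-cong D D-supp (λ π → eval-expand p x ks) ⟩
  E D (λ π → scaledMonomial ks (π ∘ x)) ∎
  where
  open Expansion
  open ℚₚ.≤-Reasoning

  ι : Fin p → Fin n
  ι i = inject≤ i p≤n

  ι-inj : Inj ι
  ι-inj = inject≤-injective p≤n p≤n

  D-supp : Supported D
  D-supp = All.map proj₁ (proj₁ D-dist)
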